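{- Let $r<n$ and let $G$ be the $r\times n$ rectangular graph with vertex set $V=\{(i,j)\mid 1\le i\le r,\ 1\le j\le n\}$. Define $\delta:V\to\mathbb Z_{\ge0}$ by $$\delta((i,j))=\begin{cases} r-2+j & \text{if } j\le n-r+1,\\ n-1 & \text{if } n-r+1<j\le n-i+1,\\ r-1 & \text{if } j>n-i+1.\end{cases}$$ Then the only orientation $D$ of $G$ in which each vertex $(i,j)$ has out-degree $\delta((i,j))$ and which does not contain a cyclic triangle is the orientation associated with the $r\times n$ circulant latin rectangle of order $n$.
   Context: The $r\times n$ rectangular graph has vertex set $\{(i,j)\}$, two distinct vertices adjacent precisely when they agree in the first or in the second coordinate. A cyclic triangle is a set of three vertices $u,v,w$ with directed edges $u\to v\to w\to u$. An $r\times n$ latin rectangle is an $r\times n$ matrix with entries in $\{0,1,\dots,n-1\}$ such that no entry is repeated in any row or column. The orientation associated with a latin rectangle $L$ is the orientation of the rectangular graph with $(i,j)\to(i,j')$ whenever $L_{ij}>L_{ij'}$, and $(i,j)\to(i',j)$ whenever $L_{ij}<L_{i'j}$. The $r\times n$ circulant latin rectangle of order $n$ is the $r\times n$ matrix whose $(i,j)$ entry is $(i+j-2)\bmod n$. -}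

module Defs where

open import Data.Nat using (ℕ; suc; _+_; _∸_; _≤_; _<_; _≤ᵇ_; _<ᵇ_; _≤?_; _<?_)
open import Data.Nat.DivMod using (_%_)
open import Data.Fin using (Fin; toℕ)
open import Data.Fin.Properties using () renaming (_≟_ to _≟ᶠ_)
open import Data.Bool using (Bool; true; false; if_then_else_; _∧_; _∨_; not)
open import Data.Product using (_×_; _,_; proj₁; proj₂; ∃-syntax)
open import Data.Sum using (_⊎_)
open import Data.Nat.ListAction using (sum)
open import Data.List using (List; map; cartesianProduct; allFin)
open import Relation.Nullary using (¬_; yes; no)
open import Relation.Nullary.Decidable using (⌊_⌋)
open import Relation.Binary.PropositionalEquality using (_≡_; _≢_)

-- Vertices of the r × n rectangular graph, 0-indexed:
-- (i , j) with i : Fin r (row), j : Fin n (column).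
V : ℕ → ℕ → Set
V r n = Fin r × Fin n

vertices : (r n : ℕ) → List (V r n)
vertices r n = cartesianProduct (allFin r) (allFin n)

Adjacent : {r n : ℕ} → V r n → V r n → Set
Adjacent (i , j) (i' , j') = (i ≡ i' × j ≢ j') ⊎ (j ≡ j' × i ≢ i')

Digraph : ℕ → ℕ → Set
Digraph r n = V r n → V r n → Bool

record IsOrientation {r n : ℕ} (D : Digraph r n) : Set where
  field
    oneDirection : ∀ u v → Adjacent u v → D u v ≡ not (D v u)
    onlyEdges    : ∀ u v → ¬ Adjacent u v → D u v ≡ false

outdeg : {r n : ℕ} → Digraph r n → V r n → ℕ
outdeg {r} {n} D u = sum (map (λ v → if D u v then 1 else 0) (vertices r n))

HasCyclicTriangle : {r n : ℕ} → Digraph r n → Set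
HasCyclicTriangle {r} {n} D =
  ∃[ u ] ∃[ v ] ∃[ w ] (D u v ≡ true × D v w ≡ true × D w u ≡ true)

-- The prescribed out-degree δ, translated to 0-indexed coordinates
-- (paper's (i,j) = (toℕ i + 1 , toℕ j + 1)):
--   j ≤ n-r+1          ⇔ toℕ j + r ≤ n       ↦ r - 2 + j = r + toℕ j ∸ 1
--   n-r+1 < j ≤ n-i+1  ⇔ toℕ j + toℕ i < n   ↦ n - 1
--   j > n-i+1          (otherwise)           ↦ r - 1
δ : {r n : ℕ} → V r n → ℕ
δ {r} {n} (i , j) with toℕ j + r ≤? n
... | yes _ = r + toℕ j ∸ 1
... | no _ with toℕ j + toℕ i <? n
...   | yes _ = n ∸ 1
...   | no _ = r ∸ 1

latinOrientation : {r n : ℕ} → (Fin r → Fin n → ℕ) → Digraph r n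
latinOrientation L (i , j) (i' , j') =
  (⌊ i ≟ᶠ i' ⌋ ∧ (L i j' <ᵇ L i j)) ∨ (⌊ j ≟ᶠ j' ⌋ ∧ (L i j <ᵇ L i' j))

-- The r × n circulant latin rectangle of order n (0-indexed):
-- entry (i , j) is (i + j) mod n  (paper: (i + j - 2) mod n, 1-indexed).
circulant : (r n : ℕ) → Fin r → Fin n → ℕ
circulant r (suc n) i j = (toℕ i + toℕ j) % suc n

-- Rows and columns of an orientation without cyclic triangles are transitive tournaments, so
-- their score sequences are permutations, they determine the orientation, and the out-degree of
-- a vertex is its row score plus its column score. In the circulant the row score of (i , j) is
-- the entry itself; writing it as rank + excess, where rank is the position of the entry within
-- its column, gives δ = r - 1 + excess. For any other admissible D the row scores a and the
-- column in-degrees x then satisfy a = x + excess. Comparing sums of squares (rows permute a and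
-- the circulant, columns permute x and rank) gives ∑ x · excess = ∑ rank · excess; a
-- rearrangement inequality in every column turns this into a lower bound on x at the unwrapped
-- cells of the wrapped columns, and induction over the rows gives x = rank, so D has the scores
-- of the circulant orientation.

{-# OPTIONS --safe #-}
module Submission where

open import Defs
open import Data.Bool using (Bool; true; false; if_then_else_; not; _∧_)
open import Data.Bool.Properties using (T-≡; T-∧; T-∨; ∨-identityʳ; ∨-idem)
open import Data.Empty using (⊥)
open import Data.Fin using (Fin; zero; suc; toℕ; fromℕ<)
open import Data.Fin.Induction using (<-wellFounded)
open import Data.Fin.Properties using (toℕ-injective; toℕ-fromℕ<; toℕ<n)
  renaming (_≟_ to _≟ᶠ_; suc-injective to suc-injectiveᶠ)
open import Data.List using ([]; _∷_; map; tabulate; allFin; cartesianProduct; _++_)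
open import Data.List.Properties using (map-tabulate; map-++; map-∘)
open import Data.Nat using (ℕ; zero; suc; _+_; _*_; _∸_; _≤_; _<_; z≤n; s≤s; z<s; _<ᵇ_; _≤ᵇ_; _<?_; _≤?_; NonZero; >-nonZero)
open import Data.Nat.DivMod using (_%_; m<n⇒m%n≡m; m≤n⇒[n∸m]%m≡n%m; m%n<n)
import Data.Nat.ListAction as ListAction
open import Data.Nat.ListAction.Properties using (sum-++)
open import Data.Nat.Properties
open import Data.Nat.Tactic.RingSolver using (solve-∀)
open import Algebra.Properties.Semiring.Sum +-*-semiring
  using (sum; sum-syntax; ∑-comm; ∑-distrib-+; sum-cong-≗; sum-replicate-zero; *-distribˡ-sum; *-distribʳ-sum)
open import Data.Product using (_×_; _,_; Σ-syntax)
open import Data.Sum using (_⊎_; inj₁; inj₂)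
open import Function using (_∘_; id)
open import Function.Bundles using (module Equivalence)
open import Induction.WellFounded using (module All)
open import Level using (0ℓ)
open import Relation.Binary.Definitions using (tri<; tri≈; tri>)
open import Relation.Binary.PropositionalEquality using (_≡_; _≢_; refl; sym; trans; cong; cong₂; subst; subst₂; module ≡-Reasoning)
open import Relation.Nullary using (¬_; yes; no; does; ⌊_⌋; contradiction)
open import Relation.Nullary.Decidable using (dec-true; dec-false; toWitness)
open import Relation.Nullary.Reflects using (ofʸ; ofⁿ)
open import Relation.Unary using (Decidable)

open Equivalence using (to; from)

𝟙 : Bool → ℕ
𝟙 b = if b then 1 else 0

∑-mono-≤ : ∀ {n} {f g : Fin n → ℕ} → (∀ k → f k ≤ g k) → sum f ≤ sum g
∑-mono-≤ {zero}  f≤g = z≤n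
∑-mono-≤ {suc n} f≤g = +-mono-≤ (f≤g zero) (∑-mono-≤ (f≤g ∘ suc))

∑≡∧≤⇒≗ : ∀ {n} {f g : Fin n → ℕ} → (∀ k → f k ≤ g k) → sum f ≡ sum g → ∀ k → f k ≡ g k
∑≡∧≤⇒≗ {suc n} {f} {g} f≤g ∑f≡∑g = λ where
    zero    → f₀≡g₀
    (suc k) → ∑≡∧≤⇒≗ (f≤g ∘ suc) tails-≡ k
  where
  f₀≡g₀ : f zero ≡ g zero
  f₀≡g₀ = ≤-antisym (f≤g zero) (+-cancelʳ-≤ (sum (g ∘ suc)) (g zero) (f zero)
            (subst (_≤ f zero + sum (g ∘ suc)) ∑f≡∑g (+-monoʳ-≤ (f zero) (∑-mono-≤ (f≤g ∘ suc)))))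
  tails-≡ : sum (f ∘ suc) ≡ sum (g ∘ suc)
  tails-≡ = +-cancelˡ-≡ (f zero) _ _ (trans ∑f≡∑g (cong (_+ sum (g ∘ suc)) (sym f₀≡g₀)))

∑-mono-< : ∀ {n} {f g : Fin n → ℕ} → (∀ k → f k ≤ g k) → ∀ k → f k < g k → sum f < sum g
∑-mono-< f≤g k fk<gk = ≤∧≢⇒< (∑-mono-≤ f≤g) (λ ∑f≡∑g → <⇒≢ fk<gk (∑≡∧≤⇒≗ f≤g ∑f≡∑g k))

∑-1 : ∀ n → ∑[ k < n ] 1 ≡ n
∑-1 zero    = refl
∑-1 (suc n) = cong suc (∑-1 n)

∑-zero : ∀ {n} {f : Fin n → ℕ} → (∀ k → f k ≡ 0) → sum f ≡ 0
∑-zero {n} f≡0 = trans (sum-cong-≗ f≡0) (sum-replicate-zero n)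

∑-single : ∀ {n} {f : Fin n → ℕ} k → (∀ l → l ≢ k → f l ≡ 0) → sum f ≡ f k
∑-single {suc n} {f} zero    off = trans (cong (f zero +_) (∑-zero (λ l → off (suc l) λ ()))) (+-identityʳ _)
∑-single {suc n} {f} (suc k) off = cong₂ _+_ (off zero λ ()) (∑-single k (λ l l≢k → off (suc l) (l≢k ∘ suc-injectiveᶠ)))

∑-𝟙-≤1 : ∀ {n} {P : Fin n → Set} (P? : Decidable P) → (∀ k l → P k → P l → k ≡ l) →
          ∑[ k < n ] 𝟙 (does (P? k)) ≤ 1
∑-𝟙-≤1 {zero}  P? unique = z≤n
∑-𝟙-≤1 {suc n} P? unique with P? zero
... | yes p₀ = ≤-reflexive (cong suc (∑-zero rest-false))
  where
  rest-false : ∀ k → 𝟙 (does (P? (suc k))) ≡ 0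
  rest-false k with P? (suc k)
  ... | no _   = refl
  ... | yes pₖ with () ← unique zero (suc k) p₀ pₖ
... | no _ = ∑-𝟙-≤1 (P? ∘ suc) (λ k l pₖ pₗ → suc-injectiveᶠ (unique (suc k) (suc l) pₖ pₗ))

count-< : ∀ n v → v ≤ n → ∑[ k < n ] 𝟙 (toℕ k <ᵇ v) ≡ v
count-< zero    zero    z≤n       = refl
count-< (suc n) zero    _         = ∑-zero {suc n} (λ _ → refl)
count-< (suc n) (suc v) (s≤s v≤n) = cong suc (count-< n v v≤n)

count-> : ∀ n v → ∑[ k < n ] 𝟙 (v <ᵇ toℕ k) ≡ n ∸ suc v
count-> zero    v       = refl
count-> (suc n) zero    = ∑-1 n
count-> (suc n) (suc v) = count-> n v

∑-+-2*-+ : ∀ {n} (f g h : Fin n → ℕ) → ∑[ k < n ] (f k + (2 * g k + h k)) ≡ sum f + (2 * sum g + sum h)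
∑-+-2*-+ f g h = trans (∑-distrib-+ f _) (cong (sum f +_)
  (trans (∑-distrib-+ (λ k → 2 * g k) h) (cong (_+ sum h) (sym (*-distribˡ-sum 2 g)))))

∑∑-square-+ : ∀ {r n} (x e : Fin r → Fin n → ℕ) →
  ∑[ i < r ] ∑[ j < n ] ((x i j + e i j) * (x i j + e i j)) ≡
  ∑[ i < r ] ∑[ j < n ] (x i j * x i j) + (2 * ∑[ i < r ] ∑[ j < n ] (x i j * e i j) + ∑[ i < r ] ∑[ j < n ] (e i j * e i j))
∑∑-square-+ {r} {n} x e = begin
  ∑[ i < r ] ∑[ j < n ] ((x i j + e i j) * (x i j + e i j))    ≡⟨ sum-cong-≗ {r} (λ i → sum-cong-≗ {n} (λ j → square-+ (x i j) (e i j))) ⟩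
  ∑[ i < r ] ∑[ j < n ] (xx i j + (2 * xe i j + ee i j))        ≡⟨ sum-cong-≗ {r} (λ i → ∑-+-2*-+ (xx i) (xe i) (ee i)) ⟩
  ∑[ i < r ] (∑xx i + (2 * ∑xe i + ∑ee i))                      ≡⟨ ∑-+-2*-+ ∑xx ∑xe ∑ee ⟩
  sum ∑xx + (2 * sum ∑xe + sum ∑ee)                             ∎
  where
  open ≡-Reasoning
  square-+ : ∀ a b → (a + b) * (a + b) ≡ a * a + (2 * (a * b) + b * b)
  square-+ = solve-∀
  xx xe ee : Fin r → Fin n → ℕ
  xx i j = x i j * x i j
  xe i j = x i j * e i j
  ee i j = e i j * e i j
  ∑xx ∑xe ∑ee : Fin r → ℕ
  ∑xx i = sum (xx i)
  ∑xe i = sum (xe i)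
  ∑ee i = sum (ee i)

∑∑-cross-term : ∀ {r n} (x y e : Fin r → Fin n → ℕ) →
  ∑[ i < r ] ∑[ j < n ] ((x i j + e i j) * (x i j + e i j)) ≡ ∑[ i < r ] ∑[ j < n ] ((y i j + e i j) * (y i j + e i j)) →
  ∑[ i < r ] ∑[ j < n ] (x i j * x i j) ≡ ∑[ i < r ] ∑[ j < n ] (y i j * y i j) →
  ∑[ i < r ] ∑[ j < n ] (x i j * e i j) ≡ ∑[ i < r ] ∑[ j < n ] (y i j * e i j)
∑∑-cross-term {r} {n} x y e squares xx≡yy = *-cancelˡ-≡ XE YE 2 (+-cancelʳ-≡ EE (2 * XE) (2 * YE) (+-cancelˡ-≡ YY _ _ (begin
  YY + (2 * XE + EE)   ≡⟨ cong (_+ (2 * XE + EE)) xx≡yy ⟨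
  XX + (2 * XE + EE)   ≡⟨ ∑∑-square-+ x e ⟨
  _                    ≡⟨ squares ⟩
  _                    ≡⟨ ∑∑-square-+ y e ⟩
  YY + (2 * YE + EE)   ∎)))
  where
  open ≡-Reasoning
  XX YY XE YE EE : ℕ
  XX = ∑[ i < r ] ∑[ j < n ] (x i j * x i j)
  YY = ∑[ i < r ] ∑[ j < n ] (y i j * y i j)
  XE = ∑[ i < r ] ∑[ j < n ] (x i j * e i j)
  YE = ∑[ i < r ] ∑[ j < n ] (y i j * e i j)
  EE = ∑[ i < r ] ∑[ j < n ] (e i j * e i j)

m∸[1+n]+n≡m∸1 : ∀ {m n} → n < m → m ∸ suc n + n ≡ m ∸ 1
m∸[1+n]+n≡m∸1 {suc m} (s≤s n≤m) = m∸n+n≡m n≤m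

-- Permutations of 0, …, n - 1

record IsPermutation {n : ℕ} (s : Fin n → ℕ) : Set where
  field
    bounded   : ∀ j → s j < n
    injective : ∀ j j' → s j ≡ s j' → j ≡ j'

-- Double counting the pairs (j , k) with s j = k: each k < n is hit exactly once.
module _ {n : ℕ} {s : Fin n → ℕ} (s-perm : IsPermutation s) where
  open IsPermutation s-perm

  private
    hit : Fin n → Fin n → ℕ
    hit j k = 𝟙 (does (s j ≟ toℕ k))

    expand : ∀ (f : ℕ → ℕ) j → f (s j) ≡ ∑[ k < n ] (hit j k * f (toℕ k))
    expand f j = sym (trans (∑-single kⱼ off) on)
      where
      kⱼ : Fin n
      kⱼ = fromℕ< (bounded j)
      kⱼ≡sⱼ : toℕ kⱼ ≡ s j
      kⱼ≡sⱼ = toℕ-fromℕ< (bounded j)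
      on : hit j kⱼ * f (toℕ kⱼ) ≡ f (s j)
      on rewrite kⱼ≡sⱼ | dec-true (s j ≟ s j) refl = +-identityʳ _
      off : ∀ k → k ≢ kⱼ → hit j k * f (toℕ k) ≡ 0
      off k k≢kⱼ rewrite dec-false (s j ≟ toℕ k) (λ sⱼ≡k → k≢kⱼ (toℕ-injective (trans (sym sⱼ≡k) (sym kⱼ≡sⱼ)))) = refl

    preimages : Fin n → ℕ
    preimages k = ∑[ j < n ] hit j k

    preimages-≤1 : ∀ k → preimages k ≤ 1
    preimages-≤1 k = ∑-𝟙-≤1 (λ j → s j ≟ toℕ k) (λ j j' sⱼ≡k sⱼ'≡k → injective j j' (trans sⱼ≡k (sym sⱼ'≡k)))

    preimages-≡1 : ∀ k → preimages k ≡ 1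
    preimages-≡1 = ∑≡∧≤⇒≗ preimages-≤1 (begin
      ∑[ k < n ] preimages k                  ≡⟨ ∑-comm hit ⟨
      ∑[ j < n ] ∑[ k < n ] hit j k           ≡⟨ sum-cong-≗ (λ j → sym (trans (expand (λ _ → 1) j) (sum-cong-≗ (λ k → *-identityʳ (hit j k))))) ⟩
      ∑[ j < n ] 1                            ∎)
      where open ≡-Reasoning

  ∑-permute : (f : ℕ → ℕ) → ∑[ j < n ] f (s j) ≡ ∑[ k < n ] f (toℕ k)
  ∑-permute f = begin
    ∑[ j < n ] f (s j)                                ≡⟨ sum-cong-≗ (expand f) ⟩
    ∑[ j < n ] ∑[ k < n ] (hit j k * f (toℕ k))       ≡⟨ ∑-comm (λ j k → hit j k * f (toℕ k)) ⟩
    ∑[ k < n ] ∑[ j < n ] (hit j k * f (toℕ k))       ≡⟨ sum-cong-≗ (λ k → *-distribʳ-sum (f (toℕ k)) (λ j → hit j k)) ⟨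
    ∑[ k < n ] (preimages k * f (toℕ k))              ≡⟨ sum-cong-≗ (λ k → trans (cong (_* f (toℕ k)) (preimages-≡1 k)) (+-identityʳ _)) ⟩
    ∑[ k < n ] f (toℕ k)                              ∎
    where open ≡-Reasoning

module _ {n : ℕ} {s t : Fin n → ℕ} (s-perm : IsPermutation s) (t-perm : IsPermutation t) where

  ∑-permute₂ : (f : ℕ → ℕ) → ∑[ j < n ] f (s j) ≡ ∑[ j < n ] f (t j)
  ∑-permute₂ f = trans (∑-permute s-perm f) (sym (∑-permute t-perm f))

  permutations-≤⇒≡ : (∀ j → s j ≤ t j) → ∀ j → s j ≡ t j
  permutations-≤⇒≡ s≤t = ∑≡∧≤⇒≗ s≤t (∑-permute₂ id)

reverse-isPermutation : ∀ {n} {s : Fin n → ℕ} → IsPermutation s → IsPermutation (λ j → n ∸ suc (s j))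
reverse-isPermutation {n} s-perm = record
  { bounded   = λ j → ∸-monoʳ-< z<s (bounded j)
  ; injective = λ j j' eq → injective j j' (suc-injective (∸-cancelˡ-≡ (bounded j) (bounded j') eq))
  }
  where open IsPermutation s-perm

-- (v - c) (𝟙 b - 𝟙 (c ≤ v)) ≤ 0, rearranged so that no subtraction occurs.
threshold-pointwise : ∀ v c b → v * 𝟙 b + c * 𝟙 (c ≤ᵇ v) ≤ v * 𝟙 (c ≤ᵇ v) + c * 𝟙 b
threshold-pointwise v c b with c ≤ᵇ v | ≤ᵇ-reflects-≤ c v | b
... | true  | _       | true  = ≤-refl
... | false | _       | false = ≤-refl
... | true  | ofʸ c≤v | false rewrite *-zeroʳ v | *-identityʳ v | *-identityʳ c | *-zeroʳ c | +-identityʳ v = c≤v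
... | false | ofⁿ c≰v | true  rewrite *-zeroʳ v | *-identityʳ v | *-identityʳ c | *-zeroʳ c | +-identityʳ v = <⇒≤ (≰⇒> c≰v)

threshold-pointwise-≡ : ∀ v c → v * 1 + c * 𝟙 (c ≤ᵇ v) ≡ v * 𝟙 (c ≤ᵇ v) + c * 1 → c ≤ v
threshold-pointwise-≡ v c eq with c ≤ᵇ v | ≤ᵇ-reflects-≤ c v
... | true  | ofʸ c≤v = c≤v
... | false | ofⁿ _ rewrite *-zeroʳ v | *-identityʳ v | *-identityʳ c | *-zeroʳ c | +-identityʳ v = ≤-reflexive (sym eq)

-- Among permutations y of 0, …, m - 1, the sum of y over the positions where z is ≥ c is
-- largest for y = z, since z puts exactly the values ≥ c there.
module _ {m : ℕ} {y z : Fin m → ℕ} (y-perm : IsPermutation y) (z-perm : IsPermutation z) (c : ℕ) where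

  private
    onTop : (Fin m → ℕ) → ℕ
    onTop w = ∑[ i < m ] (w i * 𝟙 (c ≤ᵇ z i))

    K : ℕ
    K = ∑[ i < m ] 𝟙 (c ≤ᵇ z i)

    lhs rhs : Fin m → ℕ
    lhs i = y i * 𝟙 (c ≤ᵇ z i) + c * 𝟙 (c ≤ᵇ y i)
    rhs i = y i * 𝟙 (c ≤ᵇ y i) + c * 𝟙 (c ≤ᵇ z i)

    ∑lhs : sum lhs ≡ onTop y + c * K
    ∑lhs = begin
      sum lhs                                             ≡⟨ ∑-distrib-+ (λ i → y i * 𝟙 (c ≤ᵇ z i)) _ ⟩
      onTop y + ∑[ i < m ] (c * 𝟙 (c ≤ᵇ y i))             ≡⟨ cong (onTop y +_) (*-distribˡ-sum c (λ i → 𝟙 (c ≤ᵇ y i))) ⟨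
      onTop y + c * ∑[ i < m ] 𝟙 (c ≤ᵇ y i)               ≡⟨ cong (λ k → onTop y + c * k) (∑-permute₂ y-perm z-perm (λ v → 𝟙 (c ≤ᵇ v))) ⟩
      onTop y + c * K                                     ∎
      where open ≡-Reasoning

    ∑rhs : sum rhs ≡ onTop z + c * K
    ∑rhs = begin
      sum rhs                                             ≡⟨ ∑-distrib-+ (λ i → y i * 𝟙 (c ≤ᵇ y i)) _ ⟩
      ∑[ i < m ] (y i * 𝟙 (c ≤ᵇ y i)) + ∑[ i < m ] (c * 𝟙 (c ≤ᵇ z i))
                                                          ≡⟨ cong₂ _+_ (∑-permute₂ y-perm z-perm (λ v → v * 𝟙 (c ≤ᵇ v)))
                                                                       (sym (*-distribˡ-sum c (λ i → 𝟙 (c ≤ᵇ z i)))) ⟩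
      onTop z + c * K                                     ∎
      where open ≡-Reasoning

    lhs≤rhs : ∀ i → lhs i ≤ rhs i
    lhs≤rhs i = threshold-pointwise (y i) c (c ≤ᵇ z i)

  threshold-≤ : onTop y ≤ onTop z
  threshold-≤ = +-cancelʳ-≤ (c * K) _ _ (subst₂ _≤_ ∑lhs ∑rhs (∑-mono-≤ lhs≤rhs))

  threshold-≡ : onTop y ≡ onTop z → ∀ i → c ≤ z i → c ≤ y i
  threshold-≡ eq i c≤zᵢ = threshold-pointwise-≡ (y i) c
    (subst (λ b → y i * 𝟙 b + c * 𝟙 (c ≤ᵇ y i) ≡ y i * 𝟙 (c ≤ᵇ y i) + c * 𝟙 b) (dec-true (c ≤? z i) c≤zᵢ)
      (∑≡∧≤⇒≗ lhs≤rhs (trans ∑lhs (trans (cong (_+ c * K) eq) (sym ∑rhs))) i))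

module _ {A : Set} {f g : A → ℕ} (g-injective : ∀ a b → g a ≡ g b → a ≡ b)
         (f-mono : ∀ a b → g a < g b → f a < f b) where

  mono-injective : ∀ a b → f a ≡ f b → a ≡ b
  mono-injective a b fa≡fb with <-cmp (g a) (g b)
  ... | tri< ga<gb _ _ = contradiction fa≡fb (<⇒≢ (f-mono a b ga<gb))
  ... | tri≈ _ ga≡gb _ = g-injective a b ga≡gb
  ... | tri> _ _ gb<ga = contradiction (sym fa≡fb) (<⇒≢ (f-mono b a gb<ga))

  mono-<ᵇ : ∀ a b → (f a <ᵇ f b) ≡ (g a <ᵇ g b)
  mono-<ᵇ a b with <-cmp (g a) (g b)
  ... | tri< ga<gb _ _ = trans (dec-true (f a <? f b) (f-mono a b ga<gb)) (sym (dec-true (g a <? g b) ga<gb))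
  ... | tri≈ ga≮gb ga≡gb _ = trans (dec-false (f a <? f b) (<-irrefl (cong f (g-injective a b ga≡gb))))
                                   (sym (dec-false (g a <? g b) ga≮gb))
  ... | tri> ga≮gb _ gb<ga = trans (dec-false (f a <? f b) (<⇒≯ (f-mono b a gb<ga)))
                                   (sym (dec-false (g a <? g b) ga≮gb))

-- Transitive tournaments

record IsTransitiveTournament {m : ℕ} (T : Fin m → Fin m → Bool) : Set where
  field
    irreflexive : ∀ j → T j j ≡ false
    complete    : ∀ j k → j ≢ k → T j k ≡ not (T k j)
    acyclic     : ∀ j k l → T j k ≡ true → T k l ≡ true → T l j ≡ true → ⊥

score : ∀ {m} → (Fin m → Fin m → Bool) → Fin m → ℕ
score {m} T j = ∑[ k < m ] 𝟙 (T j k)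

module _ {m : ℕ} {T : Fin m → Fin m → Bool} (transitive : IsTransitiveTournament T) where
  open IsTransitiveTournament transitive

  private
    reverse : ∀ {j k} → j ≢ k → T j k ≡ false → T k j ≡ true
    reverse {j} {k} j≢k j↛k with T k j | complete j k j≢k
    ... | true  | _ = refl
    ... | false | j→k = trans (sym j↛k) j→k

    asymmetric : ∀ {j k} → T j k ≡ true → T k j ≡ false
    asymmetric {j} {k} j→k with j ≟ᶠ k
    ... | yes refl = irreflexive j
    ... | no j≢k   = trans (complete k j (j≢k ∘ sym)) (cong not j→k)

  -- Every out-neighbour l of k is one of j, as l → j would close a cyclic triangle.
  score-decreasing : ∀ {j k} → T j k ≡ true → score T k < score T j
  score-decreasing {j} {k} j→k = ∑-mono-< k→l⇒j→l k k↛k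
    where
    k→l⇒j→l : ∀ l → 𝟙 (T k l) ≤ 𝟙 (T j l)
    k→l⇒j→l l with T k l in k→l | T j l in j→l
    ... | false | _     = z≤n
    ... | true  | true  = ≤-refl
    ... | true  | false with j ≟ᶠ l
    ...   | yes refl = contradiction (trans (sym k→l) (asymmetric j→k)) λ ()
    ...   | no j≢l   = contradiction (reverse j≢l j→l) (acyclic j k l j→k k→l)
    k↛k : 𝟙 (T k k) < 𝟙 (T j k)
    k↛k rewrite irreflexive k | j→k = s≤s z≤n

  score-isPermutation : IsPermutation (score T)
  score-isPermutation = record { bounded = bounded ; injective = injective }
    where
    bounded : ∀ j → score T j < m
    bounded j = subst (score T j <_) (∑-1 m) (∑-mono-< 𝟙≤1 j j↛j)
      where
      𝟙≤1 : ∀ k → 𝟙 (T j k) ≤ 1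
      𝟙≤1 k with T j k
      ... | true  = ≤-refl
      ... | false = z≤n
      j↛j : 𝟙 (T j j) < 1
      j↛j rewrite irreflexive j = s≤s z≤n
    injective : ∀ j k → score T j ≡ score T k → j ≡ k
    injective j k eq with j ≟ᶠ k
    ... | yes j≡k = j≡k
    ... | no j≢k with T j k in j→k
    ...   | true  = contradiction (sym eq) (<⇒≢ (score-decreasing j→k))
    ...   | false = contradiction eq (<⇒≢ (score-decreasing (reverse j≢k j→k)))

  arc≡score<ᵇ : ∀ j k → T j k ≡ (score T k <ᵇ score T j)
  arc≡score<ᵇ j k with T j k in j→k
  ... | true  = sym (dec-true (score T k <? score T j) (score-decreasing j→k))
  ... | false with j ≟ᶠ k
  ...   | yes refl = sym (dec-false (score T j <? score T j) (<-irrefl refl))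
  ...   | no j≢k   = sym (dec-false (score T k <? score T j) (<⇒≯ (score-decreasing (reverse j≢k j→k))))

row : ∀ {r n} → Digraph r n → Fin r → Fin n → Fin n → Bool
row D i j k = D (i , j) (i , k)

column : ∀ {r n} → Digraph r n → Fin n → Fin r → Fin r → Bool
column D j i k = D (i , j) (k , j)

rowScore : ∀ {r n} → Digraph r n → Fin r → Fin n → ℕ
rowScore D i = score (row D i)

columnScore : ∀ {r n} → Digraph r n → Fin r → Fin n → ℕ
columnScore D i j = score (column D j) i

¬Adjacent-refl : ∀ {r n} (u : V r n) → ¬ Adjacent u u
¬Adjacent-refl u (inj₁ (_ , j≢j)) = j≢j refl
¬Adjacent-refl u (inj₂ (_ , i≢i)) = i≢i refl

module _ {r n : ℕ} {D : Digraph r n} (orientation : IsOrientation D) (noCycle : ¬ HasCyclicTriangle D) where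
  open IsOrientation orientation

  row-transitive : ∀ i → IsTransitiveTournament (row D i)
  row-transitive i = record
    { irreflexive = λ j → onlyEdges _ _ (¬Adjacent-refl _)
    ; complete    = λ j k j≢k → oneDirection _ _ (inj₁ (refl , j≢k))
    ; acyclic     = λ j k l j→k k→l l→j → noCycle (_ , _ , _ , j→k , k→l , l→j)
    }

  column-transitive : ∀ j → IsTransitiveTournament (column D j)
  column-transitive j = record
    { irreflexive = λ i → onlyEdges _ _ (¬Adjacent-refl _)
    ; complete    = λ i k i≢k → oneDirection _ _ (inj₂ (refl , i≢k))
    ; acyclic     = λ i k l i→k k→l l→i → noCycle (_ , _ , _ , i→k , k→l , l→i)
    }

list-∑-allFin : ∀ {n} (f : Fin n → ℕ) → ListAction.sum (map f (allFin n)) ≡ ∑[ k < n ] f k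
list-∑-allFin f = trans (cong ListAction.sum (map-tabulate id f)) (sum-tabulate f)
  where
  sum-tabulate : ∀ {n} (f : Fin n → ℕ) → ListAction.sum (tabulate f) ≡ ∑[ k < n ] f k
  sum-tabulate {zero}  f = refl
  sum-tabulate {suc n} f = cong (f zero +_) (sum-tabulate (f ∘ suc))

list-∑-cartesianProduct : ∀ {A B : Set} (f : A × B → ℕ) xs ys →
  ListAction.sum (map f (cartesianProduct xs ys)) ≡ ListAction.sum (map (λ x → ListAction.sum (map (λ y → f (x , y)) ys)) xs)
list-∑-cartesianProduct f []       ys = refl
list-∑-cartesianProduct f (x ∷ xs) ys = begin
  ListAction.sum (map f (map (x ,_) ys ++ cartesianProduct xs ys))
    ≡⟨ cong ListAction.sum (map-++ f (map (x ,_) ys) _) ⟩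
  ListAction.sum (map f (map (x ,_) ys) ++ map f (cartesianProduct xs ys))
    ≡⟨ sum-++ (map f (map (x ,_) ys)) _ ⟩
  ListAction.sum (map f (map (x ,_) ys)) + ListAction.sum (map f (cartesianProduct xs ys))
    ≡⟨ cong₂ _+_ (cong ListAction.sum (sym (map-∘ ys))) (list-∑-cartesianProduct f xs ys) ⟩
  ListAction.sum (map (λ y → f (x , y)) ys) + ListAction.sum (map (λ x → ListAction.sum (map (λ y → f (x , y)) ys)) xs) ∎
  where open ≡-Reasoning

outdeg≡∑∑ : ∀ {r n} (D : Digraph r n) u → outdeg D u ≡ ∑[ i < r ] ∑[ j < n ] 𝟙 (D u (i , j))
outdeg≡∑∑ {r} {n} D u = begin
  outdeg D u
    ≡⟨ list-∑-cartesianProduct (𝟙 ∘ D u) (allFin r) (allFin n) ⟩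
  ListAction.sum (map (λ i → ListAction.sum (map (λ j → 𝟙 (D u (i , j))) (allFin n))) (allFin r))
    ≡⟨ list-∑-allFin (λ i → ListAction.sum (map (λ j → 𝟙 (D u (i , j))) (allFin n))) ⟩
  ∑[ i < r ] ListAction.sum (map (λ j → 𝟙 (D u (i , j))) (allFin n))
    ≡⟨ sum-cong-≗ {r} (λ i → list-∑-allFin (λ j → 𝟙 (D u (i , j)))) ⟩
  ∑[ i < r ] ∑[ j < n ] 𝟙 (D u (i , j)) ∎
  where open ≡-Reasoning

-- Off its own row, u = (i , j) can only point into its own column.
outdeg≡rowScore+columnScore : ∀ {r n} {D : Digraph r n} → IsOrientation D →
  ∀ i j → outdeg D (i , j) ≡ rowScore D i j + columnScore D i j
outdeg≡rowScore+columnScore {r} {n} {D} orientation i j = begin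
  outdeg D (i , j)                                                         ≡⟨ outdeg≡∑∑ D (i , j) ⟩
  ∑[ i' < r ] ∑[ j' < n ] 𝟙 (D (i , j) (i' , j'))                          ≡⟨ sum-cong-≗ split ⟩
  ∑[ i' < r ] (inRow i' + 𝟙 (D (i , j) (i' , j)))                          ≡⟨ ∑-distrib-+ inRow _ ⟩
  ∑[ i' < r ] inRow i' + columnScore D i j                                 ≡⟨ cong (_+ columnScore D i j) (∑-single i inRow-off) ⟩
  inRow i + columnScore D i j                                              ≡⟨ cong (_+ columnScore D i j) inRow-on ⟩
  rowScore D i j + columnScore D i j                                       ∎
  where
  open ≡-Reasoning
  open IsOrientation orientation
  inRow : Fin r → ℕ
  inRow i' = 𝟙 (does (i' ≟ᶠ i)) * rowScore D i j
  inRow-on : inRow i ≡ rowScore D i j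
  inRow-on rewrite dec-true (i ≟ᶠ i) refl = +-identityʳ _
  inRow-off : ∀ i' → i' ≢ i → inRow i' ≡ 0
  inRow-off i' i'≢i rewrite dec-false (i' ≟ᶠ i) i'≢i = refl
  split : ∀ i' → ∑[ j' < n ] 𝟙 (D (i , j) (i' , j')) ≡ inRow i' + 𝟙 (D (i , j) (i' , j))
  split i' with i' ≟ᶠ i
  ... | yes refl rewrite onlyEdges (i' , j) (i' , j) (¬Adjacent-refl _) = sym (trans (+-identityʳ _) (+-identityʳ _))
  ... | no i'≢i  = ∑-single j (λ j' j'≢j → cong 𝟙 (onlyEdges _ _ λ where
                     (inj₁ (i≡i' , _)) → i'≢i (sym i≡i')
                     (inj₂ (j≡j' , _)) → j'≢j (sym j≡j')))

module _ {r n : ℕ} {D D' : Digraph r n}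
  (orientation  : IsOrientation D)  (noCycle  : ¬ HasCyclicTriangle D)
  (orientation' : IsOrientation D') (noCycle' : ¬ HasCyclicTriangle D') where

  ≡-byScores : (∀ i j → rowScore D i j ≡ rowScore D' i j) → (∀ i j → columnScore D i j ≡ columnScore D' i j) →
               ∀ u v → D u v ≡ D' u v
  ≡-byScores rows columns (i , j) (i' , j') with i ≟ᶠ i' | j ≟ᶠ j'
  ... | yes refl | _ = begin
    row D i j j'                                ≡⟨ arc≡score<ᵇ (row-transitive orientation noCycle i) j j' ⟩
    (rowScore D i j' <ᵇ rowScore D i j)         ≡⟨ cong₂ _<ᵇ_ (rows i j') (rows i j) ⟩
    (rowScore D' i j' <ᵇ rowScore D' i j)       ≡⟨ arc≡score<ᵇ (row-transitive orientation' noCycle' i) j j' ⟨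
    row D' i j j'                               ∎
    where open ≡-Reasoning
  ... | no _ | yes refl = begin
    column D j i i'                             ≡⟨ arc≡score<ᵇ (column-transitive orientation noCycle j) i i' ⟩
    (columnScore D i' j <ᵇ columnScore D i j)   ≡⟨ cong₂ _<ᵇ_ (columns i' j) (columns i j) ⟩
    (columnScore D' i' j <ᵇ columnScore D' i j) ≡⟨ arc≡score<ᵇ (column-transitive orientation' noCycle' j) i i' ⟨
    column D' j i i'                            ∎
    where open ≡-Reasoning
  ... | no i≢i' | no j≢j' = trans (IsOrientation.onlyEdges orientation _ _ ¬adjacent)
                                  (sym (IsOrientation.onlyEdges orientation' _ _ ¬adjacent))
    where
    ¬adjacent : ¬ Adjacent (i , j) (i' , j')
    ¬adjacent (inj₁ (i≡i' , _)) = i≢i' i≡i'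
    ¬adjacent (inj₂ (j≡j' , _)) = j≢j' j≡j'

module _ {r n : ℕ} (L : Fin r → Fin n → ℕ) where

  latin-row : ∀ i j k → latinOrientation L (i , j) (i , k) ≡ (L i k <ᵇ L i j)
  latin-row i j k with i ≟ᶠ i | j ≟ᶠ k
  ... | no i≢i | _        = contradiction refl i≢i
  ... | yes _  | yes refl = ∨-idem _
  ... | yes _  | no _     = ∨-identityʳ _

  latin-column : ∀ i j k → latinOrientation L (i , j) (k , j) ≡ (L i j <ᵇ L k j)
  latin-column i j k with j ≟ᶠ j | i ≟ᶠ k
  ... | no j≢j | _        = contradiction refl j≢j
  ... | yes _  | yes refl = ∨-idem _
  ... | yes _  | no _     = refl

  latin-arc : ∀ ((i , j) (i' , j') : V r n) → latinOrientation L (i , j) (i' , j') ≡ true →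
              (i ≡ i' × L i j' < L i j) ⊎ (j ≡ j' × L i j < L i' j)
  latin-arc (i , j) (i' , j') arc with T-∨ {⌊ i ≟ᶠ i' ⌋ ∧ (L i j' <ᵇ L i j)} .to (T-≡ .from arc)
  ... | inj₁ sameRow    = let (i≡i' , <ᵇ) = T-∧ {⌊ i ≟ᶠ i' ⌋} .to sameRow    in inj₁ (toWitness i≡i' , <ᵇ⇒< _ _ <ᵇ)
  ... | inj₂ sameColumn = let (j≡j' , <ᵇ) = T-∧ {⌊ j ≟ᶠ j' ⌋} .to sameColumn in inj₂ (toWitness j≡j' , <ᵇ⇒< _ _ <ᵇ)

  -- Row arcs decrease L and column arcs increase it; a triangle mixing both has two equal vertices.
  latin-noCyclicTriangle : ¬ HasCyclicTriangle (latinOrientation L)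
  latin-noCyclicTriangle (u@(_ , _) , v@(_ , _) , w@(_ , _) , u→v , v→w , w→u)
    with latin-arc u v u→v | latin-arc v w v→w | latin-arc w u w→u
  ... | inj₁ (refl , v<u) | inj₁ (refl , w<v) | inj₁ (refl , u<w) = <-irrefl refl (<-trans v<u (<-trans u<w w<v))
  ... | inj₂ (refl , u<v) | inj₂ (refl , v<w) | inj₂ (refl , w<u) = <-irrefl refl (<-trans u<v (<-trans v<w w<u))
  ... | inj₁ (refl , _)   | inj₁ (refl , _)   | inj₂ (refl , w<u) = <-irrefl refl w<u
  ... | inj₁ (refl , _)   | inj₂ (refl , v<w) | inj₁ (refl , _)   = <-irrefl refl v<w
  ... | inj₂ (refl , u<v) | inj₁ (refl , _)   | inj₁ (refl , _)   = <-irrefl refl u<v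
  ... | inj₁ (refl , v<u) | inj₂ (refl , _)   | inj₂ (refl , _)   = <-irrefl refl v<u
  ... | inj₂ (refl , _)   | inj₁ (refl , w<v) | inj₂ (refl , _)   = <-irrefl refl w<v
  ... | inj₂ (refl , _)   | inj₂ (refl , _)   | inj₁ (refl , u<w) = <-irrefl refl u<w

  latin-isOrientation : (∀ i j k → L i j ≡ L i k → j ≡ k) → (∀ j i k → L i j ≡ L k j → i ≡ k) →
                        IsOrientation (latinOrientation L)
  latin-isOrientation rowInjective columnInjective = record { oneDirection = oneDirection ; onlyEdges = onlyEdges }
    where
    <ᵇ-flip : ∀ {a b} → a ≢ b → (a <ᵇ b) ≡ not (b <ᵇ a)
    <ᵇ-flip {a} {b} a≢b with <-cmp a b
    ... | tri< a<b _ _ = trans (dec-true (a <? b) a<b) (cong not (sym (dec-false (b <? a) (<⇒≯ a<b))))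
    ... | tri≈ _ a≡b _ = contradiction a≡b a≢b
    ... | tri> _ _ b<a = trans (dec-false (a <? b) (<⇒≯ b<a)) (cong not (sym (dec-true (b <? a) b<a)))
    oneDirection : ∀ u v → Adjacent u v → latinOrientation L u v ≡ not (latinOrientation L v u)
    oneDirection (i , j) (_ , k) (inj₁ (refl , j≢k)) rewrite latin-row i j k | latin-row i k j =
      <ᵇ-flip (j≢k ∘ sym ∘ rowInjective i k j)
    oneDirection (i , j) (k , _) (inj₂ (refl , i≢k)) rewrite latin-column i j k | latin-column k j i =
      <ᵇ-flip (i≢k ∘ columnInjective j i k)
    onlyEdges : ∀ u v → ¬ Adjacent u v → latinOrientation L u v ≡ false
    onlyEdges u@(_ , _) v@(_ , _) ¬adjacent with latinOrientation L u v in u→v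
    ... | false = refl
    ... | true with latin-arc u v u→v
    ...   | inj₁ (refl , v<u) = contradiction (inj₁ (refl , λ { refl → <-irrefl refl v<u })) ¬adjacent
    ...   | inj₂ (refl , u<v) = contradiction (inj₂ (refl , λ { refl → <-irrefl refl u<v })) ¬adjacent

  latin-rowScore : ∀ i → IsPermutation (L i) → ∀ j → rowScore (latinOrientation L) i j ≡ L i j
  latin-rowScore i row-perm j = begin
    ∑[ k < n ] 𝟙 (latinOrientation L (i , j) (i , k))  ≡⟨ sum-cong-≗ (cong 𝟙 ∘ latin-row i j) ⟩
    ∑[ k < n ] 𝟙 (L i k <ᵇ L i j)                       ≡⟨ ∑-permute row-perm (λ v → 𝟙 (v <ᵇ L i j)) ⟩
    ∑[ k < n ] 𝟙 (toℕ k <ᵇ L i j)                       ≡⟨ count-< n (L i j) (<⇒≤ (IsPermutation.bounded row-perm j)) ⟩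
    L i j                                               ∎
    where open ≡-Reasoning

  latin-columnScore : ∀ j {K : Fin r → ℕ} → IsPermutation K → (∀ i k → (L i j <ᵇ L k j) ≡ (K i <ᵇ K k)) →
                      ∀ i → columnScore (latinOrientation L) i j ≡ r ∸ suc (K i)
  latin-columnScore j {K} K-perm sameOrder i = begin
    ∑[ k < r ] 𝟙 (latinOrientation L (i , j) (k , j))  ≡⟨ sum-cong-≗ (λ k → cong 𝟙 (trans (latin-column i j k) (sameOrder i k))) ⟩
    ∑[ k < r ] 𝟙 (K i <ᵇ K k)                           ≡⟨ ∑-permute K-perm (λ v → 𝟙 (K i <ᵇ v)) ⟩
    ∑[ k < r ] 𝟙 (K i <ᵇ toℕ k)                         ≡⟨ count-> r (K i) ⟩
    r ∸ suc (K i)                                       ∎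
    where open ≡-Reasoning

-- The circulant

module Circulant {r n : ℕ} .{{_ : NonZero n}} (r<n : r < n) where

  circ : Fin r → Fin n → ℕ
  circ i j = (toℕ i + toℕ j) % n

  wrap : Fin n → ℕ
  wrap j = toℕ j + r ∸ n

  -- The three cases in the definition of δ.
  data Region (i : Fin r) (j : Fin n) : Set where
    left   : toℕ j + r ≤ n → Region i j
    middle : n < toℕ j + r → toℕ i + toℕ j < n → Region i j
    right  : n < toℕ j + r → n ≤ toℕ i + toℕ j → Region i j

  region : ∀ i j → Region i j
  region i j with toℕ j + r ≤? n | toℕ j + toℕ i <? n
  ... | yes j+r≤n | _         = left j+r≤n
  ... | no j+r≰n  | yes j+i<n = middle (≰⇒> j+r≰n) (subst (_< n) (+-comm (toℕ j) (toℕ i)) j+i<n)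
  ... | no j+r≰n  | no j+i≮n  = right (≰⇒> j+r≰n) (subst (n ≤_) (+-comm (toℕ j) (toℕ i)) (≮⇒≥ j+i≮n))

  Region-irrelevant : ∀ {i j} (ρ ρ' : Region i j) → ρ ≡ ρ'
  Region-irrelevant (left p)     (left p')      = cong left (≤-irrelevant p p')
  Region-irrelevant (middle p q) (middle p' q') = cong₂ middle (<-irrelevant p p') (<-irrelevant q q')
  Region-irrelevant (right p q)  (right p' q')  = cong₂ right (<-irrelevant p p') (≤-irrelevant q q')
  Region-irrelevant (left p)     (middle p' _)  = contradiction p (<⇒≱ p')
  Region-irrelevant (left p)     (right p' _)   = contradiction p (<⇒≱ p')
  Region-irrelevant (middle p _) (left p')      = contradiction p' (<⇒≱ p)
  Region-irrelevant (right p _)  (left p')      = contradiction p' (<⇒≱ p)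
  Region-irrelevant (middle _ q) (right _ q')   = contradiction q' (<⇒≱ q)
  Region-irrelevant (right _ q)  (middle _ q')  = contradiction q (<⇒≱ q')

  -- circ = rank + excess, where rank i j is the position of circ i j among the entries of
  -- column j and δ (i , j) = r - 1 + excess i j.
  rankIn : ∀ {i j} → Region i j → ℕ
  rankIn {i}     (left _)     = toℕ i
  rankIn {i} {j} (middle _ _) = toℕ i + wrap j
  rankIn {i} {j} (right _ _)  = toℕ i + toℕ j ∸ n

  excessIn : ∀ {i j} → Region i j → ℕ
  excessIn {j = j} (left _)     = toℕ j
  excessIn         (middle _ _) = n ∸ r
  excessIn         (right _ _)  = 0

  rank : Fin r → Fin n → ℕ
  rank i j = rankIn (region i j)

  excess : Fin r → Fin n → ℕ
  excess i j = excessIn (region i j)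

  rank≡rankIn : ∀ {i j} (ρ : Region i j) → rank i j ≡ rankIn ρ
  rank≡rankIn {i} {j} ρ = cong rankIn (Region-irrelevant (region i j) ρ)

  excess≡excessIn : ∀ {i j} (ρ : Region i j) → excess i j ≡ excessIn ρ
  excess≡excessIn {i} {j} ρ = cong excessIn (Region-irrelevant (region i j) ρ)

  1≤r : Fin r → 1 ≤ r
  1≤r i = ≤-<-trans z≤n (toℕ<n i)

  δ≡r∸1+excess : ∀ i j → δ (i , j) ≡ r ∸ 1 + excess i j
  δ≡r∸1+excess i j with toℕ j + r ≤? n
  ... | yes _ = +-∸-comm (toℕ j) (1≤r i)
  ... | no _ with toℕ j + toℕ i <? n
  ...   | yes _ = begin
    n ∸ 1                ≡⟨ cong (_∸ 1) (m+[n∸m]≡n (<⇒≤ r<n)) ⟨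
    r + (n ∸ r) ∸ 1      ≡⟨ +-∸-comm (n ∸ r) (1≤r i) ⟩
    r ∸ 1 + (n ∸ r)      ∎
    where open ≡-Reasoning
  ...   | no _  = sym (+-identityʳ (r ∸ 1))

  wrap+n : ∀ j → n < toℕ j + r → wrap j + n ≡ toℕ j + r
  wrap+n j n<j+r = m∸n+n≡m (<⇒≤ n<j+r)

  right<wrap : ∀ i j → n ≤ toℕ i + toℕ j → toℕ i + toℕ j ∸ n < wrap j
  right<wrap i j n≤i+j = ∸-monoˡ-< (subst (toℕ i + toℕ j <_) (+-comm r (toℕ j)) (+-monoˡ-< (toℕ j) (toℕ<n i))) n≤i+j

  circ-low : ∀ i j → toℕ i + toℕ j < n → circ i j ≡ toℕ i + toℕ j
  circ-low i j = m<n⇒m%n≡m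

  circ-high : ∀ i j → n ≤ toℕ i + toℕ j → circ i j ≡ toℕ i + toℕ j ∸ n
  circ-high i j n≤i+j = begin
    (toℕ i + toℕ j) % n        ≡⟨ m≤n⇒[n∸m]%m≡n%m n≤i+j ⟨
    (toℕ i + toℕ j ∸ n) % n    ≡⟨ m<n⇒m%n≡m (m<n+o⇒m∸n<o (toℕ i + toℕ j) n i+j<n+n) ⟩
    toℕ i + toℕ j ∸ n          ∎
    where
    open ≡-Reasoning
    i+j<n+n : toℕ i + toℕ j < n + n
    i+j<n+n = +-mono-< (<-trans (toℕ<n i) r<n) (toℕ<n j)

  circ≡rankIn+excessIn : ∀ {i j} (ρ : Region i j) → circ i j ≡ rankIn ρ + excessIn ρ
  circ≡rankIn+excessIn {i} {j} (left j+r≤n) =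
    circ-low i j (<-≤-trans (subst (_< toℕ j + r) (+-comm (toℕ j) (toℕ i)) (+-monoʳ-< (toℕ j) (toℕ<n i))) j+r≤n)
  circ≡rankIn+excessIn {i} {j} (middle n<j+r i+j<n) = begin
    circ i j                          ≡⟨ circ-low i j i+j<n ⟩
    toℕ i + toℕ j                     ≡⟨ cong (toℕ i +_) (+-cancelʳ-≡ r _ _ wrap+[n∸r]+r) ⟨
    toℕ i + (wrap j + (n ∸ r))        ≡⟨ +-assoc (toℕ i) (wrap j) (n ∸ r) ⟨
    toℕ i + wrap j + (n ∸ r)          ∎
    where
    open ≡-Reasoning
    wrap+[n∸r]+r : wrap j + (n ∸ r) + r ≡ toℕ j + r
    wrap+[n∸r]+r = trans (+-assoc (wrap j) (n ∸ r) r) (trans (cong (wrap j +_) (m∸n+n≡m (<⇒≤ r<n))) (wrap+n j n<j+r))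
  circ≡rankIn+excessIn {i} {j} (right _ n≤i+j) = trans (circ-high i j n≤i+j) (sym (+-identityʳ _))

  circ≡rank+excess : ∀ i j → circ i j ≡ rank i j + excess i j
  circ≡rank+excess i j = circ≡rankIn+excessIn (region i j)

  rankIn<r : ∀ {i j} (ρ : Region i j) → rankIn ρ < r
  rankIn<r {i}     (left _) = toℕ<n i
  rankIn<r {i} {j} (middle n<j+r i+j<n) = +-cancelʳ-< n _ _ (begin-strict
    toℕ i + wrap j + n        ≡⟨ +-assoc (toℕ i) (wrap j) n ⟩
    toℕ i + (wrap j + n)      ≡⟨ cong (toℕ i +_) (wrap+n j n<j+r) ⟩
    toℕ i + (toℕ j + r)       ≡⟨ +-assoc (toℕ i) (toℕ j) r ⟨
    toℕ i + toℕ j + r         <⟨ +-monoˡ-< r i+j<n ⟩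
    n + r                     ≡⟨ +-comm n r ⟩
    r + n                     ∎)
    where open ≤-Reasoning
  rankIn<r {i} {j} (right _ n≤i+j) =
    <-≤-trans (right<wrap i j n≤i+j) (m≤n+o⇒m∸n≤o (toℕ j + r) n (+-monoˡ-≤ r (<⇒≤ (toℕ<n j))))

  rankIn-injective : ∀ {i k j} (ρ : Region i j) (ρ' : Region k j) → rankIn ρ ≡ rankIn ρ' → i ≡ k
  rankIn-injective (left _)     (left _)     eq = toℕ-injective eq
  rankIn-injective (middle _ _) (middle _ _) eq = toℕ-injective (+-cancelʳ-≡ _ _ _ eq)
  rankIn-injective (right _ q)  (right _ q') eq = toℕ-injective (+-cancelʳ-≡ _ _ _ (∸-cancelʳ-≡ q q' eq))
  rankIn-injective {i} {k} {j} (middle _ _) (right _ q') eq =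
    contradiction (≤-trans (m≤n+m (wrap j) (toℕ i)) (≤-reflexive eq)) (<⇒≱ (right<wrap k j q'))
  rankIn-injective {i} {k} {j} (right _ q)  (middle _ _) eq =
    contradiction (≤-trans (m≤n+m (wrap j) (toℕ k)) (≤-reflexive (sym eq))) (<⇒≱ (right<wrap i j q))
  rankIn-injective (left p)     (middle p' _) _ = contradiction p (<⇒≱ p')
  rankIn-injective (left p)     (right p' _)  _ = contradiction p (<⇒≱ p')
  rankIn-injective (middle p _) (left p')     _ = contradiction p' (<⇒≱ p)
  rankIn-injective (right p _)  (left p')     _ = contradiction p' (<⇒≱ p)

  excessIn-mono : ∀ {i k j} (ρ : Region i j) (ρ' : Region k j) → rankIn ρ < rankIn ρ' → excessIn ρ ≤ excessIn ρ'
  excessIn-mono (right _ _)  _              _  = z≤n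
  excessIn-mono (left _)     (left _)       _  = ≤-refl
  excessIn-mono (middle _ _) (middle _ _)   _  = ≤-refl
  excessIn-mono {i} {k} {j} (middle _ _) (right _ q') lt =
    contradiction (<-trans (right<wrap k j q') (≤-<-trans (m≤n+m (wrap j) (toℕ i)) lt)) (<-irrefl refl)
  excessIn-mono (left p)     (middle p' _)  _  = contradiction p (<⇒≱ p')
  excessIn-mono (left p)     (right p' _)   _  = contradiction p (<⇒≱ p')
  excessIn-mono (middle p _) (left p')      _  = contradiction p' (<⇒≱ p)

  rank-isPermutation : ∀ j → IsPermutation (λ i → rank i j)
  rank-isPermutation j = record
    { bounded   = λ i → rankIn<r (region i j)
    ; injective = λ i k → rankIn-injective (region i j) (region k j)
    }

  circ-mono-rank : ∀ j i k → rank i j < rank k j → circ i j < circ k j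
  circ-mono-rank j i k lt = subst₂ _<_ (sym (circ≡rank+excess i j)) (sym (circ≡rank+excess k j))
    (+-mono-<-≤ lt (excessIn-mono (region i j) (region k j) lt))

  circ-column-<ᵇ : ∀ j i k → (circ i j <ᵇ circ k j) ≡ (rank i j <ᵇ rank k j)
  circ-column-<ᵇ j = mono-<ᵇ (IsPermutation.injective (rank-isPermutation j)) (circ-mono-rank j)

  circ-column-injective : ∀ j i k → circ i j ≡ circ k j → i ≡ k
  circ-column-injective j = mono-injective (IsPermutation.injective (rank-isPermutation j)) (circ-mono-rank j)

  -- In row i the unwrapped entries i + j are ≥ i and the wrapped ones i + j - n are < i.
  circ-row-isPermutation : ∀ i → IsPermutation (circ i)
  circ-row-isPermutation i = record { bounded = λ j → m%n<n (toℕ i + toℕ j) n ; injective = injective }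
    where
    circ<i : ∀ j → n ≤ toℕ i + toℕ j → circ i j < toℕ i
    circ<i j n≤i+j = subst (_< toℕ i) (sym (circ-high i j n≤i+j))
      (subst (toℕ i + toℕ j ∸ n <_) (m+n∸n≡m (toℕ i) n) (∸-monoˡ-< (+-monoʳ-< (toℕ i) (toℕ<n j)) n≤i+j))
    injective : ∀ j k → circ i j ≡ circ i k → j ≡ k
    injective j k eq with toℕ i + toℕ j <? n | toℕ i + toℕ k <? n
    ... | yes i+j<n | yes i+k<n = toℕ-injective (+-cancelˡ-≡ (toℕ i) _ _
            (trans (sym (circ-low i j i+j<n)) (trans eq (circ-low i k i+k<n))))
    ... | no i+j≮n  | no i+k≮n  = toℕ-injective (+-cancelˡ-≡ (toℕ i) _ _ (∸-cancelʳ-≡ (≮⇒≥ i+j≮n) (≮⇒≥ i+k≮n)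
            (trans (sym (circ-high i j (≮⇒≥ i+j≮n))) (trans eq (circ-high i k (≮⇒≥ i+k≮n))))))
    ... | yes i+j<n | no i+k≮n  = contradiction (subst (toℕ i ≤_) (trans (sym (circ-low i j i+j<n)) eq) (m≤m+n (toℕ i) (toℕ j)))
                                                (<⇒≱ (circ<i k (≮⇒≥ i+k≮n)))
    ... | no i+j≮n  | yes i+k<n = contradiction (subst (toℕ i ≤_) (trans (sym (circ-low i k i+k<n)) (sym eq)) (m≤m+n (toℕ i) (toℕ k)))
                                                (<⇒≱ (circ<i j (≮⇒≥ i+j≮n)))

  excess-wrapped : ∀ j → n < toℕ j + r → ∀ i → excess i j ≡ (n ∸ r) * 𝟙 (wrap j ≤ᵇ rank i j)
  excess-wrapped j n<j+r i with region i j
  ... | left j+r≤n  = contradiction j+r≤n (<⇒≱ n<j+r)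
  ... | middle _ _  = sym (trans (cong (λ b → (n ∸ r) * 𝟙 b) (dec-true (wrap j ≤? _) (m≤n+m (wrap j) (toℕ i))))
                                 (*-identityʳ (n ∸ r)))
  ... | right _ q   = sym (trans (cong (λ b → (n ∸ r) * 𝟙 b) (dec-false (wrap j ≤? _) (<⇒≱ (right<wrap i j q))))
                                 (*-zeroʳ (n ∸ r)))

  earlierRow : ∀ (i : Fin r) {t} → t < toℕ i → Σ[ k ∈ Fin r ] (toℕ k ≡ t × toℕ k < toℕ i)
  earlierRow i t<i = k , toℕ-fromℕ< _ , subst (_< toℕ i) (sym (toℕ-fromℕ< _)) t<i
    where k = fromℕ< (<-trans t<i (toℕ<n i))

  -- A value below rank i j is the rank of an earlier row of column j, except that in a wrapped
  -- column the values below wrap j are the ranks of the wrapped rows at the bottom.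
  rankIn-earlier : ∀ {i j} (ρ : Region i j) {v} → v < rankIn ρ → (wrap j ≤ rankIn ρ → wrap j ≤ v) →
                   Σ[ k ∈ Fin r ] (toℕ k < toℕ i × rank k j ≡ v)
  rankIn-earlier {i} (left j+r≤n) v<i _ =
    let (k , k≡v , k<i) = earlierRow i v<i in k , k<i , trans (rank≡rankIn (left j+r≤n)) k≡v
  rankIn-earlier {i} {j} (middle n<j+r i+j<n) {v} v<i+w wrap≤v =
    let (k , k≡v∸w , k<i) = earlierRow i v∸w<i
    in k , k<i , trans (rank≡rankIn (middle n<j+r (<-trans (+-monoˡ-< (toℕ j) k<i) i+j<n)))
                       (trans (cong (_+ wrap j) k≡v∸w) (m∸n+n≡m w≤v))
    where
    w≤v = wrap≤v (m≤n+m (wrap j) (toℕ i))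
    v∸w<i : v ∸ wrap j < toℕ i
    v∸w<i = +-cancelʳ-< (wrap j) _ _ (subst (_< toℕ i + wrap j) (sym (m∸n+n≡m w≤v)) v<i+w)
  rankIn-earlier {i} {j} (right n<j+r n≤i+j) {v} v<i+j∸n _ =
    let (k , k≡v+w , k<i) = earlierRow i v+w<i
        k+j≡v+n = trans (cong (_+ toℕ j) k≡v+w) (trans (+-assoc v w (toℕ j)) (cong (v +_) w+j≡n))
    in k , k<i , trans (rank≡rankIn (right n<j+r (subst (n ≤_) (sym k+j≡v+n) (m≤n+m n v))))
                       (trans (cong (_∸ n) k+j≡v+n) (m+n∸n≡m v n))
    where
    w = n ∸ toℕ j
    w+j≡n : w + toℕ j ≡ n
    w+j≡n = m∸n+n≡m (<⇒≤ (toℕ<n j))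
    v+w<i : v + w < toℕ i
    v+w<i = +-cancelʳ-< (toℕ j) _ _ (subst₂ _<_ (trans (cong (v +_) (sym w+j≡n)) (sym (+-assoc v w (toℕ j)))) (m∸n+n≡m n≤i+j)
              (+-monoˡ-< n v<i+j∸n))

  C : Digraph r n
  C = latinOrientation circ

  C-isOrientation : IsOrientation C
  C-isOrientation = latin-isOrientation circ (IsPermutation.injective ∘ circ-row-isPermutation) circ-column-injective

  C-noCyclicTriangle : ¬ HasCyclicTriangle C
  C-noCyclicTriangle = latin-noCyclicTriangle circ

  C-rowScore : ∀ i j → rowScore C i j ≡ circ i j
  C-rowScore i = latin-rowScore circ i (circ-row-isPermutation i)

  C-columnScore : ∀ i j → columnScore C i j ≡ r ∸ suc (rank i j)
  C-columnScore i j = latin-columnScore circ j (rank-isPermutation j) (circ-column-<ᵇ j) i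

  C-outdeg : ∀ u → outdeg C u ≡ δ u
  C-outdeg (i , j) = begin
    outdeg C (i , j)                              ≡⟨ outdeg≡rowScore+columnScore C-isOrientation i j ⟩
    rowScore C i j + columnScore C i j            ≡⟨ cong₂ _+_ (trans (C-rowScore i j) (circ≡rank+excess i j)) (C-columnScore i j) ⟩
    rank i j + excess i j + (r ∸ suc (rank i j))  ≡⟨ +-comm (rank i j + excess i j) _ ⟩
    r ∸ suc (rank i j) + (rank i j + excess i j)  ≡⟨ +-assoc (r ∸ suc (rank i j)) _ _ ⟨
    r ∸ suc (rank i j) + rank i j + excess i j    ≡⟨ cong (_+ excess i j) (m∸[1+n]+n≡m∸1 (rankIn<r (region i j))) ⟩
    r ∸ 1 + excess i j                            ≡⟨ δ≡r∸1+excess i j ⟨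
    δ (i , j)                                     ∎
    where open ≡-Reasoning

  module Uniqueness {D : Digraph r n} (orientation : IsOrientation D) (noCycle : ¬ HasCyclicTriangle D)
                    (outdeg≡δ : ∀ u → outdeg D u ≡ δ u) where

    a : Fin r → Fin n → ℕ
    a = rowScore D

    -- The in-degree of (i , j) within its column, the counterpart of rank.
    x : Fin r → Fin n → ℕ
    x i j = r ∸ suc (columnScore D i j)

    a-isPermutation : ∀ i → IsPermutation (a i)
    a-isPermutation i = score-isPermutation (row-transitive orientation noCycle i)

    columnScore-isPermutation : ∀ j → IsPermutation (λ i → columnScore D i j)
    columnScore-isPermutation j = score-isPermutation (column-transitive orientation noCycle j)

    x-isPermutation : ∀ j → IsPermutation (λ i → x i j)
    x-isPermutation j = reverse-isPermutation (columnScore-isPermutation j)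

    a≡x+excess : ∀ i j → a i j ≡ x i j + excess i j
    a≡x+excess i j = +-cancelʳ-≡ b _ _ (begin
      a i j + b                   ≡⟨ outdeg≡rowScore+columnScore orientation i j ⟨
      outdeg D (i , j)            ≡⟨ outdeg≡δ (i , j) ⟩
      δ (i , j)                   ≡⟨ δ≡r∸1+excess i j ⟩
      r ∸ 1 + excess i j          ≡⟨ cong (_+ excess i j) (m∸[1+n]+n≡m∸1 (IsPermutation.bounded (columnScore-isPermutation j) i)) ⟨
      x i j + b + excess i j      ≡⟨ +-assoc (x i j) b _ ⟩
      x i j + (b + excess i j)    ≡⟨ cong (x i j +_) (+-comm b _) ⟩
      x i j + (excess i j + b)    ≡⟨ +-assoc (x i j) _ b ⟨
      x i j + excess i j + b      ∎)
      where
      open ≡-Reasoning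
      b = columnScore D i j

    -- Row sums of squares of a and circ agree, and so do column sums of squares of x and rank.
    totalWeight-≡ : ∑[ i < r ] ∑[ j < n ] (x i j * excess i j) ≡ ∑[ i < r ] ∑[ j < n ] (rank i j * excess i j)
    totalWeight-≡ = ∑∑-cross-term x rank excess
      (sum-cong-≗ {r} λ i → begin
        ∑[ j < n ] ((x i j + excess i j) * (x i j + excess i j))        ≡⟨ sum-cong-≗ {n} (λ j → cong (λ v → v * v) (sym (a≡x+excess i j))) ⟩
        ∑[ j < n ] (a i j * a i j)                                      ≡⟨ ∑-permute₂ (a-isPermutation i) (circ-row-isPermutation i) (λ v → v * v) ⟩
        ∑[ j < n ] (circ i j * circ i j)                                ≡⟨ sum-cong-≗ {n} (λ j → cong (λ v → v * v) (circ≡rank+excess i j)) ⟩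
        ∑[ j < n ] ((rank i j + excess i j) * (rank i j + excess i j))  ∎)
      (begin
        ∑[ i < r ] ∑[ j < n ] (x i j * x i j)         ≡⟨ ∑-comm (λ i j → x i j * x i j) ⟩
        ∑[ j < n ] ∑[ i < r ] (x i j * x i j)         ≡⟨ sum-cong-≗ {n} (λ j → ∑-permute₂ (x-isPermutation j) (rank-isPermutation j) (λ v → v * v)) ⟩
        ∑[ j < n ] ∑[ i < r ] (rank i j * rank i j)   ≡⟨ ∑-comm (λ i j → rank i j * rank i j) ⟨
        ∑[ i < r ] ∑[ j < n ] (rank i j * rank i j)   ∎)
      where open ≡-Reasoning

    columnWeight : (Fin r → Fin n → ℕ) → Fin n → ℕ
    columnWeight y j = ∑[ i < r ] (y i j * excess i j)

    columnWeight-wrapped : ∀ y j → n < toℕ j + r → columnWeight y j ≡ (n ∸ r) * ∑[ i < r ] (y i j * 𝟙 (wrap j ≤ᵇ rank i j))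
    columnWeight-wrapped y j n<j+r = trans
      (sum-cong-≗ {r} λ i → trans (cong (y i j *_) (excess-wrapped j n<j+r i)) (x*[y*z]≡y*[x*z] (y i j) (n ∸ r) _))
      (sym (*-distribˡ-sum (n ∸ r) (λ i → y i j * 𝟙 (wrap j ≤ᵇ rank i j))))
      where
      x*[y*z]≡y*[x*z] : ∀ a b c → a * (b * c) ≡ b * (a * c)
      x*[y*z]≡y*[x*z] = solve-∀

    columnWeight-≤ : ∀ j → columnWeight x j ≤ columnWeight rank j
    columnWeight-≤ j with ≤-<-connex (toℕ j + r) n
    ... | inj₁ j+r≤n = ≤-reflexive (begin
      columnWeight x j                    ≡⟨ sum-cong-≗ {r} (λ i → cong (x i j *_) (excess≡excessIn (left {i} j+r≤n))) ⟩
      ∑[ i < r ] (x i j * toℕ j)          ≡⟨ *-distribʳ-sum (toℕ j) (λ i → x i j) ⟨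
      ∑[ i < r ] x i j * toℕ j            ≡⟨ cong (_* toℕ j) (∑-permute₂ (x-isPermutation j) (rank-isPermutation j) id) ⟩
      ∑[ i < r ] rank i j * toℕ j         ≡⟨ *-distribʳ-sum (toℕ j) (λ i → rank i j) ⟩
      ∑[ i < r ] (rank i j * toℕ j)       ≡⟨ sum-cong-≗ {r} (λ i → cong (rank i j *_) (excess≡excessIn (left {i} j+r≤n))) ⟨
      columnWeight rank j                 ∎)
      where open ≡-Reasoning
    ... | inj₂ n<j+r = subst₂ _≤_ (sym (columnWeight-wrapped x j n<j+r)) (sym (columnWeight-wrapped rank j n<j+r))
      (*-monoʳ-≤ (n ∸ r) (threshold-≤ (x-isPermutation j) (rank-isPermutation j) (wrap j)))

    columnWeight-≡ : ∀ j → columnWeight x j ≡ columnWeight rank j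
    columnWeight-≡ = ∑≡∧≤⇒≗ columnWeight-≤
      (trans (sym (∑-comm (λ i j → x i j * excess i j))) (trans totalWeight-≡ (∑-comm (λ i j → rank i j * excess i j))))

    x-wrap-bound : ∀ i j → wrap j ≤ rank i j → wrap j ≤ x i j
    x-wrap-bound i j with ≤-<-connex (toℕ j + r) n
    ... | inj₁ j+r≤n = λ _ → subst (_≤ x i j) (sym (m≤n⇒m∸n≡0 j+r≤n)) z≤n
    ... | inj₂ n<j+r = threshold-≡ (x-isPermutation j) (rank-isPermutation j) (wrap j)
      (*-cancelˡ-≡ _ _ (n ∸ r) {{>-nonZero (m<n⇒0<n∸m r<n)}}
        (trans (sym (columnWeight-wrapped x j n<j+r)) (trans (columnWeight-≡ j) (columnWeight-wrapped rank j n<j+r)))) i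

    -- Row by row from the top: x i j < rank i j is impossible as that value is taken in column j
    -- by an earlier row, so a i ≥ circ i pointwise, and both are permutations of 0, …, n - 1.
    x≡rank : ∀ i j → x i j ≡ rank i j
    x≡rank = All.wfRec <-wellFounded 0ℓ (λ i → ∀ j → x i j ≡ rank i j) rowStep
      where
      rowStep : ∀ i → (∀ {k} → toℕ k < toℕ i → ∀ j → x k j ≡ rank k j) → ∀ j → x i j ≡ rank i j
      rowStep i earlier = λ j → +-cancelʳ-≡ (excess i j) _ _ (sym (circ≡a j))
        where
        rank≤x : ∀ j → rank i j ≤ x i j
        rank≤x j = ≮⇒≥ λ x<rank →
          let (k , k<i , rankₖ≡x) = rankIn-earlier (region i j) x<rank (x-wrap-bound i j)
          in <-irrefl (cong toℕ (IsPermutation.injective (x-isPermutation j) k i (trans (earlier k<i j) rankₖ≡x))) k<i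
        circ≡a : ∀ j → rank i j + excess i j ≡ x i j + excess i j
        circ≡a j = trans (sym (circ≡rank+excess i j)) (trans
          (permutations-≤⇒≡ (circ-row-isPermutation i) (a-isPermutation i)
            (λ j → subst₂ _≤_ (sym (circ≡rank+excess i j)) (sym (a≡x+excess i j)) (+-monoˡ-≤ (excess i j) (rank≤x j))) j)
          (a≡x+excess i j))

    rowScore≡ : ∀ i j → rowScore D i j ≡ rowScore C i j
    rowScore≡ i j = begin
      a i j                   ≡⟨ a≡x+excess i j ⟩
      x i j + excess i j      ≡⟨ cong (_+ excess i j) (x≡rank i j) ⟩
      rank i j + excess i j   ≡⟨ circ≡rank+excess i j ⟨
      circ i j                ≡⟨ C-rowScore i j ⟨
      rowScore C i j          ∎
      where open ≡-Reasoning

    columnScore≡ : ∀ i j → columnScore D i j ≡ columnScore C i j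
    columnScore≡ i j = +-cancelˡ-≡ (rowScore D i j) _ _ (begin
      rowScore D i j + columnScore D i j   ≡⟨ outdeg≡rowScore+columnScore orientation i j ⟨
      outdeg D (i , j)                     ≡⟨ trans (outdeg≡δ (i , j)) (sym (C-outdeg (i , j))) ⟩
      outdeg C (i , j)                     ≡⟨ outdeg≡rowScore+columnScore C-isOrientation i j ⟩
      rowScore C i j + columnScore C i j   ≡⟨ cong (_+ columnScore C i j) (rowScore≡ i j) ⟨
      rowScore D i j + columnScore C i j   ∎)
      where open ≡-Reasoning

    D≡C : ∀ u v → D u v ≡ C u v
    D≡C = ≡-byScores orientation noCycle C-isOrientation C-noCyclicTriangle rowScore≡ columnScore≡

lemma2p4 : (r n : ℕ) → r < n →
    (IsOrientation (latinOrientation (circulant r n))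
      × (∀ u → outdeg (latinOrientation (circulant r n)) u ≡ δ u)
      × ¬ HasCyclicTriangle (latinOrientation (circulant r n)))
    × (∀ (D : Digraph r n) → IsOrientation D → (∀ u → outdeg D u ≡ δ u) →
        ¬ HasCyclicTriangle D →
        ∀ u v → D u v ≡ latinOrientation (circulant r n) u v)
lemma2p4 r zero    ()
lemma2p4 r (suc n) r<n =
  (C-isOrientation , C-outdeg , C-noCyclicTriangle) ,
  λ D orientation outdeg≡δ noCycle → Uniqueness.D≡C orientation noCycle outdeg≡δ
  where open Circulant {r} {suc n} r<n
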